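{- Let $r$ and $n$ be positive integers and $\{\alpha_j^{(i)}: 1\le j\le n,\ 1\le i\le r\}$ a set of commuting variables. For $0\le k\le r$ and an increasing tuple $1\le i_1<\cdots<i_{r-k}\le r$, let \[X=X(i_1,\dots,i_{r-k})=\sum_{(i_1',\dots,i_k')}\ \sum_{1\le j_1<j_2<\cdots<j_k\le n}\alpha_{j_1}^{(i_1')}\alpha_{j_2}^{(i_2')}\cdots\alpha_{j_k}^{(i_k')},\] where the outer sum runs over all $k$-tuples of pairwise distinct elements of $[r]\setminus\{i_1,\dots,i_{r-k}\}$ (for $k=0$, $X=1$), and let \[Y=\sum_{(i_1',\dots,i_r')}\ \sum_{1\le j_1<\cdots<j_r\le n}\alpha_{j_1}^{(i_1')}\alpha_{j_2}^{(i_2')}\cdots\alpha_{j_r}^{(i_r')},\] where the outer sum runs over all $r$-tuples of pairwise distinct elements of $[r]$. Then: (1) if $r>n$, then $\displaystyle\sum_{k=0}^{r}(-1)^k\sum_{1\le i_1<\cdots<i_{r-k}\le r}(r-k)!\Big(\sum_{j=1}^n\alpha_j^{(i_1)}\alpha_j^{(i_2)}\cdots\alpha_j^{(i_{r-k})}\Big)X=0$; (2) if $r\le n$, then $\displaystyle\sum_{k=0}^{r-1}(-1)^k\sum_{1\le i_1<\cdots<i_{r-k}\le r}(r-k)!\Big(\sum_{j=1}^n\alpha_j^{(i_1)}\alpha_j^{(i_2)}\cdots\alpha_j^{(i_{r-k})}\Big)X+(-1)^r\,r\,Y=0$.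
   Context: $[r]=\{1,\dots,r\}$. In each summand, $X$ depends on the tuple $(i_1,\dots,i_{r-k})$ of that summand. -}

module Defs where

open import Level using (Level)
open import Algebra.Bundles using (CommutativeRing)
open import Data.Nat using (ℕ; zero; suc; _∸_)
open import Data.Nat using (_!)
open import Data.Fin using (Fin)
import Data.Fin as Fin
open import Data.Bool using (Bool; true; false; not; _∨_)
open import Data.List using (List; []; _∷_; map; _++_; concatMap; upTo; allFin; zipWith; filterᵇ; foldr)
open import Data.Product using (_×_; _,_)
open import Relation.Nullary.Decidable using (⌊_⌋)

-- strictly increasing m-tuples drawn from a list (in list order):
-- choose m (allFin r) enumerates all 1 ≤ i₁ < ⋯ < iₘ ≤ r
choose : ∀ {a} {A : Set a} → ℕ → List A → List (List A)
choose zero    xs       = [] ∷ []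
choose (suc m) []       = []
choose (suc m) (x ∷ xs) = map (x ∷_) (choose m xs) ++ choose (suc m) xs

picks : ∀ {a} {A : Set a} → List A → List (A × List A)
picks []       = []
picks (x ∷ xs) = (x , xs) ∷ map (λ { (y , ys) → (y , x ∷ ys) }) (picks xs)

-- all k-tuples of pairwise distinct entries (distinct positions) of a list
arrangements : ∀ {a} {A : Set a} → ℕ → List A → List (List A)
arrangements zero    xs = [] ∷ []
arrangements (suc k) xs =
  concatMap (λ { (y , ys) → map (y ∷_) (arrangements k ys) }) (picks xs)

memb : ∀ {r} → Fin r → List (Fin r) → Bool
memb i []       = false
memb i (j ∷ js) = ⌊ i Fin.≟ j ⌋ ∨ memb i js

complement : ∀ r → List (Fin r) → List (Fin r)
complement r is = filterᵇ (λ i → not (memb i is)) (allFin r)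

module Poly {c ℓ : Level} (R : CommutativeRing c ℓ) where
  open CommutativeRing R

  Σ : List Carrier → Carrier
  Σ = foldr _+_ 0#

  Π : List Carrier → Carrier
  Π = foldr _*_ 1#

  nat : ℕ → Carrier
  nat zero    = 0#
  nat (suc m) = 1# + nat m

  sgn : ℕ → Carrier → Carrier
  sgn zero    x = x
  sgn (suc k) x = - sgn k x

  module _ (r n : ℕ) (α : Fin r → Fin n → Carrier) where

    inner : List (Fin r) → Carrier
    inner is' = Σ (map (λ js → Π (zipWith α is' js)) (choose (Data.List.length is') (allFin n)))

    X : ℕ → List (Fin r) → Carrier
    X k is = Σ (map inner (arrangements k (complement r is)))

    Y : Carrier
    Y = Σ (map inner (arrangements r (allFin r)))

    P : List (Fin r) → Carrier
    P is = Σ (map (λ j → Π (map (λ i → α i j) is)) (allFin n))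

    term : ℕ → Carrier
    term k = sgn k (Σ (map (λ is → nat ((r ∸ k) !) * (P is * X k is))
                           (choose (r ∸ k) (allFin r))))

    LHS₁ : Carrier
    LHS₁ = Σ (map term (upTo (suc r)))

    LHS₂ : Carrier
    LHS₂ = Σ (map term (upTo r)) + sgn r (nat r * Y)

module Submission where

-- For a list L of colours write p_I = Σ_j Π_{i ∈ I} α_j^{(i)} (powerSum) and e_T for the sum,
-- over all orderings (i'_1, …, i'_k) of T, of Σ_{j_1 < ⋯ < j_k} Π α_{j_l}^{(i'_l)} (arrangementSum).
-- Then X = e_{[r] ∖ I}, Y = e_{[r]}, and (-1)^r times the left side of (2) is the Newton-type sum
--   Σ_{m=1}^{|L|} (-1)^m m! Σ_{|I| = m} p_I e_{L ∖ I} + |L| e_L      (newtonSum, L = [r]),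
-- which vanishes for every L by induction on n.  Splitting off the variable j = 1 gives
-- p_I = Π_{i ∈ I} α_1^{(i)} + p'_I and e_T = e'_T + Σ_{x ∈ T} α_1^{(x)} e'_{T ∖ x}; after regrouping, the cross
-- terms Π_{i ∈ I} α_1^{(i)} e'_T telescope in m, and what is left is the sum for n - 1 variables on L plus
-- Σ_{x ∈ L} α_1^{(x)} times the sum for n - 1 variables on L ∖ x.  When r > n there is no increasing
-- r-tuple in [n], so the k = r term and Y vanish and (1) is (2).

open import Defs
open import Level using (Level)
open import Algebra.Bundles using (CommutativeRing)
open import Data.Nat using (ℕ; _≤_; _<_)
open import Data.Fin using (Fin)
open import Data.Product using (_×_)

open import Data.Nat as ℕ using (zero; suc; _∸_; _!; s≤s)
import Data.Nat.Properties as ℕₚ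
import Data.Fin as Fin
open import Data.Bool using (true; false; not)
open import Data.List using (List; []; _∷_; map; _++_; concatMap; upTo; applyUpTo; allFin; zipWith; length; filterᵇ)
import Data.List.Properties as List
open import Data.List.Relation.Unary.All as All using (All; []; _∷_)
import Data.List.Relation.Unary.All.Properties as All
open import Data.List.Relation.Unary.AllPairs using ([]; _∷_)
open import Data.List.Relation.Unary.Unique.Propositional using (Unique)
import Data.List.Relation.Unary.Unique.Propositional.Properties as Unique
open import Data.Product using (_,_; proj₁; proj₂; map₁; map₂; uncurry)
open import Function using (_∘_; id)
open import Relation.Binary.PropositionalEquality as ≡ using (_≡_; _≢_)
open import Relation.Nullary using (yes; no)
open import Data.Empty using (⊥-elim)

private variable
  a b : Level
  A : Set a
  B : Set b

splits : ℕ → List A → List (List A × List A)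
splits zero    xs       = ([] , xs) ∷ []
splits (suc m) []       = []
splits (suc m) (x ∷ xs) = map (map₁ (x ∷_)) (splits m xs) ++ map (map₂ (x ∷_)) (splits (suc m) xs)

allFin-suc : ∀ n → allFin (suc n) ≡ Fin.zero ∷ map Fin.suc (allFin n)
allFin-suc n = ≡.cong (Fin.zero ∷_) (≡.sym (List.map-tabulate id Fin.suc))

zipWith-mapʳ : ∀ {c d e} {C : Set c} {D : Set d} {E : Set e} (f : A → D → E) (g : C → D) xs ys →
               zipWith f xs (map g ys) ≡ zipWith (λ x y → f x (g y)) xs ys
zipWith-mapʳ f g []       ys       = ≡.refl
zipWith-mapʳ f g (x ∷ xs) []       = ≡.refl
zipWith-mapʳ f g (x ∷ xs) (y ∷ ys) = ≡.cong (f x (g y) ∷_) (zipWith-mapʳ f g xs ys)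

choose-map : ∀ (f : A → B) m xs → choose m (map f xs) ≡ map (map f) (choose m xs)
choose-map f zero    xs       = ≡.refl
choose-map f (suc m) []       = ≡.refl
choose-map f (suc m) (x ∷ xs) = begin
  map (f x ∷_) (choose m (map f xs)) ++ choose (suc m) (map f xs)
    ≡⟨ ≡.cong₂ (λ u v → map (f x ∷_) u ++ v) (choose-map f m xs) (choose-map f (suc m) xs) ⟩
  map (f x ∷_) (map (map f) (choose m xs)) ++ map (map f) (choose (suc m) xs)
    ≡⟨ ≡.cong (_++ _) (≡.trans (≡.sym (List.map-∘ (choose m xs))) (List.map-∘ (choose m xs))) ⟩
  map (map f) (map (x ∷_) (choose m xs)) ++ map (map f) (choose (suc m) xs)
    ≡⟨ List.map-++ (map f) (map (x ∷_) (choose m xs)) _ ⟨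
  map (map f) (map (x ∷_) (choose m xs) ++ choose (suc m) xs) ∎
  where open ≡.≡-Reasoning

choose-suc-allFin : ∀ k n → choose (suc k) (allFin (suc n))
  ≡ map ((Fin.zero ∷_) ∘ map Fin.suc) (choose k (allFin n)) ++ map (map Fin.suc) (choose (suc k) (allFin n))
choose-suc-allFin k n = begin
  choose (suc k) (allFin (suc n))
    ≡⟨ ≡.cong (choose (suc k)) (allFin-suc n) ⟩
  map (Fin.zero ∷_) (choose k (map Fin.suc (allFin n))) ++ choose (suc k) (map Fin.suc (allFin n))
    ≡⟨ ≡.cong₂ (λ u v → map (Fin.zero ∷_) u ++ v) (choose-map Fin.suc k (allFin n)) (choose-map Fin.suc (suc k) (allFin n)) ⟩
  map (Fin.zero ∷_) (map (map Fin.suc) (choose k (allFin n))) ++ map (map Fin.suc) (choose (suc k) (allFin n))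
    ≡⟨ ≡.cong (_++ map (map Fin.suc) (choose (suc k) (allFin n))) (List.map-∘ (choose k (allFin n))) ⟨
  map ((Fin.zero ∷_) ∘ map Fin.suc) (choose k (allFin n)) ++ map (map Fin.suc) (choose (suc k) (allFin n)) ∎
  where open ≡.≡-Reasoning

choose-all : ∀ {p} {P : A → Set p} m {xs} → All P xs → All (All P) (choose m xs)
choose-all zero    _          = [] ∷ []
choose-all (suc m) []         = []
choose-all (suc m) (px ∷ pxs) =
  All.++⁺ (All.map⁺ (All.map (px ∷_) (choose-all m pxs))) (choose-all (suc m) pxs)

choose-short : ∀ m (xs : List A) → length xs < m → choose m xs ≡ []
choose-short (suc m) []       _         = ≡.refl
choose-short (suc m) (x ∷ xs) (s≤s lt) =
  ≡.cong₂ _++_ (≡.cong (map (x ∷_)) (choose-short m xs lt)) (choose-short (suc m) xs (ℕₚ.m<n⇒m<1+n lt))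

splits-short : ∀ m (xs : List A) → length xs < m → splits m xs ≡ []
splits-short (suc m) []       _         = ≡.refl
splits-short (suc m) (x ∷ xs) (s≤s lt) =
  ≡.cong₂ _++_ (≡.cong (map _) (splits-short m xs lt)) (≡.cong (map _) (splits-short (suc m) xs (ℕₚ.m<n⇒m<1+n lt)))

splits-one : ∀ (xs : List A) → splits 1 xs ≡ map (map₁ (_∷ [])) (picks xs)
splits-one []       = ≡.refl
splits-one (x ∷ xs) = ≡.cong ((x ∷ [] , xs) ∷_) (begin
  map (map₂ (x ∷_)) (splits 1 xs)                   ≡⟨ ≡.cong (map _) (splits-one xs) ⟩
  map (map₂ (x ∷_)) (map (map₁ (_∷ [])) (picks xs)) ≡⟨ List.map-∘ (picks xs) ⟨
  map (map₁ (_∷ []) ∘ map₂ (x ∷_)) (picks xs)         ≡⟨ List.map-∘ (picks xs) ⟩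
  map (map₁ (_∷ [])) (map (map₂ (x ∷_)) (picks xs)) ∎)
  where open ≡.≡-Reasoning

picks-length : ∀ (xs : List A) → All (λ p → length xs ≡ suc (length (proj₂ p))) (picks xs)
picks-length []       = []
picks-length (x ∷ xs) = ≡.refl ∷ All.map⁺ (All.map (≡.cong suc) (picks-length xs))

splits-length : ∀ m (xs : List A) → All (λ p → length (proj₂ p) ℕ.+ m ≡ length xs) (splits m xs)
splits-length zero    xs       = ℕₚ.+-identityʳ _ ∷ []
splits-length (suc m) []       = []
splits-length (suc m) (x ∷ xs) = All.++⁺
  (All.map⁺ (All.map (λ {p} e → ≡.trans (ℕₚ.+-suc (length (proj₂ p)) m) (≡.cong suc e)) (splits-length m xs)))
  (All.map⁺ (All.map (≡.cong suc) (splits-length (suc m) xs)))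

module _ {r : ℕ} where

  _∖_ : List (Fin r) → List (Fin r) → List (Fin r)
  xs ∖ is = filterᵇ (λ i → not (memb i is)) xs

  memb-∉ : ∀ {x : Fin r} is → All (x ≢_) is → memb x is ≡ false
  memb-∉ {x} []       []            = ≡.refl
  memb-∉ {x} (i ∷ is) (x≢i ∷ x∉is) with x Fin.≟ i
  ... | yes x≡i = ⊥-elim (x≢i x≡i)
  ... | no  _   = memb-∉ is x∉is

  ∖-[] : ∀ xs → xs ∖ [] ≡ xs
  ∖-[] []       = ≡.refl
  ∖-[] (x ∷ xs) = ≡.cong (x ∷_) (∖-[] xs)

  ∖-keep : ∀ {x} xs is → All (x ≢_) is → (x ∷ xs) ∖ is ≡ x ∷ xs ∖ is
  ∖-keep xs is x∉is rewrite memb-∉ is x∉is = ≡.refl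

  ∖-drop : ∀ {x} xs is → All (x ≢_) xs → xs ∖ (x ∷ is) ≡ xs ∖ is
  ∖-drop []       is []            = ≡.refl
  ∖-drop {x} (y ∷ xs) is (x≢y ∷ x∉xs) with y Fin.≟ x | memb y is
  ... | yes y≡x | _     = ⊥-elim (x≢y (≡.sym y≡x))
  ... | no  _   | true  = ∖-drop xs is x∉xs
  ... | no  _   | false = ≡.cong (y ∷_) (∖-drop xs is x∉xs)

  ∖-cons : ∀ {x} xs is → All (x ≢_) xs → (x ∷ xs) ∖ (x ∷ is) ≡ xs ∖ is
  ∖-cons {x} xs is x∉xs with x Fin.≟ x
  ... | yes _   = ∖-drop xs is x∉xs
  ... | no  x≢x = ⊥-elim (x≢x ≡.refl)

  choose-with-complement : ∀ m {xs} → Unique xs → map (λ is → is , xs ∖ is) (choose m xs) ≡ splits m xs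
  choose-with-complement zero    {xs}     _              = ≡.cong (λ ys → ([] , ys) ∷ []) (∖-[] xs)
  choose-with-complement (suc m) {[]}     _              = ≡.refl
  choose-with-complement (suc m) {x ∷ xs} (x∉xs ∷ uniq) = begin
    map f (map (x ∷_) (choose m xs) ++ choose (suc m) xs)
      ≡⟨ List.map-++ f (map (x ∷_) (choose m xs)) _ ⟩
    map f (map (x ∷_) (choose m xs)) ++ map f (choose (suc m) xs)
      ≡⟨ ≡.cong₂ _++_ withHead withoutHead ⟩
    map (map₁ (x ∷_)) (splits m xs) ++ map (map₂ (x ∷_)) (splits (suc m) xs) ∎
    where
    open ≡.≡-Reasoning
    f : List (Fin r) → List (Fin r) × List (Fin r)
    f is = is , (x ∷ xs) ∖ is
    withHead : map f (map (x ∷_) (choose m xs)) ≡ map (map₁ (x ∷_)) (splits m xs)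
    withHead = begin
      map f (map (x ∷_) (choose m xs))
        ≡⟨ List.map-∘ (choose m xs) ⟨
      map (f ∘ (x ∷_)) (choose m xs)
        ≡⟨ List.map-cong (λ is → ≡.cong (x ∷ is ,_) (∖-cons xs is x∉xs)) (choose m xs) ⟩
      map (map₁ (x ∷_) ∘ (λ is → is , xs ∖ is)) (choose m xs)
        ≡⟨ List.map-∘ (choose m xs) ⟩
      map (map₁ (x ∷_)) (map (λ is → is , xs ∖ is) (choose m xs))
        ≡⟨ ≡.cong (map _) (choose-with-complement m uniq) ⟩
      map (map₁ (x ∷_)) (splits m xs) ∎
    withoutHead : map f (choose (suc m) xs) ≡ map (map₂ (x ∷_)) (splits (suc m) xs)
    withoutHead = begin
      map f (choose (suc m) xs)
        ≡⟨ List.map-cong-local (All.map (λ {is} x∉is → ≡.cong (is ,_) (∖-keep xs is x∉is)) (choose-all (suc m) x∉xs)) ⟩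
      map (map₂ (x ∷_) ∘ (λ is → is , xs ∖ is)) (choose (suc m) xs)
        ≡⟨ List.map-∘ (choose (suc m) xs) ⟩
      map (map₂ (x ∷_)) (map (λ is → is , xs ∖ is) (choose (suc m) xs))
        ≡⟨ ≡.cong (map _) (choose-with-complement (suc m) uniq) ⟩
      map (map₂ (x ∷_)) (splits (suc m) xs) ∎

module _ {c ℓ : Level} (R : CommutativeRing c ℓ) where
  open CommutativeRing R hiding (zero)
  open Poly R
  open import Algebra.Properties.Ring ring using (-‿distribˡ-*; -‿involutive; -‿+-comm; -0#≈0#)
  import Algebra.Properties.Semiring.Mult semiring as Mult
  open import Algebra.Properties.Group +-group using (\\-leftDividesʳ)
  open import Algebra.Properties.CommutativeSemigroup *-commutativeSemigroup using (x∙yz≈y∙xz)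
  open import Algebra.Solver.Ring.NaturalCoefficients.Default commutativeSemiring
  open import Relation.Binary.Reasoning.Setoid setoid


  Σ-++ : ∀ xs ys → Σ (xs ++ ys) ≈ Σ xs + Σ ys
  Σ-++ []       ys = sym (+-identityˡ _)
  Σ-++ (x ∷ xs) ys = trans (+-congˡ (Σ-++ xs ys)) (sym (+-assoc _ _ _))

  Σ-map-++ : ∀ (f : A → Carrier) xs ys → Σ (map f (xs ++ ys)) ≈ Σ (map f xs) + Σ (map f ys)
  Σ-map-++ f xs ys = trans (reflexive (≡.cong Σ (List.map-++ f xs ys))) (Σ-++ (map f xs) (map f ys))

  Σ-map : ∀ (f : B → Carrier) (g : A → B) xs → Σ (map f (map g xs)) ≡ Σ (map (f ∘ g) xs)
  Σ-map f g xs = ≡.cong Σ (≡.sym (List.map-∘ xs))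

  Σ-cong : ∀ {f g : A → Carrier} → (∀ x → f x ≈ g x) → ∀ xs → Σ (map f xs) ≈ Σ (map g xs)
  Σ-cong f≈g []       = refl
  Σ-cong f≈g (x ∷ xs) = +-cong (f≈g x) (Σ-cong f≈g xs)

  Σ-congᴬ : ∀ {f g : A → Carrier} {xs} → All (λ x → f x ≈ g x) xs → Σ (map f xs) ≈ Σ (map g xs)
  Σ-congᴬ []           = refl
  Σ-congᴬ (fx≈gx ∷ ps) = +-cong fx≈gx (Σ-congᴬ ps)

  Σ-zero : ∀ {f : A → Carrier} → (∀ x → f x ≈ 0#) → ∀ xs → Σ (map f xs) ≈ 0#
  Σ-zero f≈0 []       = refl
  Σ-zero f≈0 (x ∷ xs) = trans (+-cong (f≈0 x) (Σ-zero f≈0 xs)) (+-identityˡ _)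

  Σ-zeroᴬ : ∀ {f : A → Carrier} {xs} → All (λ x → f x ≈ 0#) xs → Σ (map f xs) ≈ 0#
  Σ-zeroᴬ []           = refl
  Σ-zeroᴬ (fx≈0 ∷ ps) = trans (+-cong fx≈0 (Σ-zeroᴬ ps)) (+-identityˡ _)

  Σ-+ : ∀ (f g : A → Carrier) xs → Σ (map (λ x → f x + g x) xs) ≈ Σ (map f xs) + Σ (map g xs)
  Σ-+ f g []       = sym (+-identityˡ _)
  Σ-+ f g (x ∷ xs) = trans (+-congˡ (Σ-+ f g xs)) (solve 4 (λ a b c d → (a :+ b) :+ (c :+ d) := (a :+ c) :+ (b :+ d)) refl _ _ _ _)

  Σ-*ˡ : ∀ k (f : A → Carrier) xs → Σ (map (λ x → k * f x) xs) ≈ k * Σ (map f xs)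
  Σ-*ˡ k f []       = sym (zeroʳ k)
  Σ-*ˡ k f (x ∷ xs) = trans (+-congˡ (Σ-*ˡ k f xs)) (sym (distribˡ k _ _))

  Σ-concatMap : ∀ (f : B → Carrier) (g : A → List B) xs →
                Σ (map f (concatMap g xs)) ≈ Σ (map (λ x → Σ (map f (g x))) xs)
  Σ-concatMap f g []       = refl
  Σ-concatMap f g (x ∷ xs) = trans (Σ-map-++ f (g x) (concatMap g xs)) (+-congˡ (Σ-concatMap f g xs))

  sumBelow : ℕ → (ℕ → Carrier) → Carrier
  sumBelow zero    f = 0#
  sumBelow (suc N) f = f 0 + sumBelow N (f ∘ suc)

  Σ-upTo : ∀ N f → Σ (map f (upTo N)) ≡ sumBelow N f
  Σ-upTo N f = go id N
    where
    go : ∀ g N → Σ (map f (applyUpTo g N)) ≡ sumBelow N (f ∘ g)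
    go g zero    = ≡.refl
    go g (suc N) = ≡.cong (f (g 0) +_) (go (g ∘ suc) N)

  sumBelow-cong : ∀ N {f g : ℕ → Carrier} → (∀ k → k < N → f k ≈ g k) → sumBelow N f ≈ sumBelow N g
  sumBelow-cong zero    f≈g = refl
  sumBelow-cong (suc N) f≈g = +-cong (f≈g 0 (s≤s ℕ.z≤n)) (sumBelow-cong N (λ k k<N → f≈g (suc k) (s≤s k<N)))

  sumBelow-zero : ∀ N {f : ℕ → Carrier} → (∀ k → f k ≈ 0#) → sumBelow N f ≈ 0#
  sumBelow-zero zero    f≈0 = refl
  sumBelow-zero (suc N) f≈0 = trans (+-cong (f≈0 0) (sumBelow-zero N (f≈0 ∘ suc))) (+-identityˡ _)

  sumBelow-+ : ∀ N (f g : ℕ → Carrier) → sumBelow N (λ k → f k + g k) ≈ sumBelow N f + sumBelow N g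
  sumBelow-+ zero    f g = sym (+-identityˡ _)
  sumBelow-+ (suc N) f g = trans (+-congˡ (sumBelow-+ N (f ∘ suc) (g ∘ suc)))
    (solve 4 (λ a b c d → (a :+ b) :+ (c :+ d) := (a :+ c) :+ (b :+ d)) refl _ _ _ _)

  sumBelow-*ˡ : ∀ N c (f : ℕ → Carrier) → sumBelow N (λ m → c * f m) ≈ c * sumBelow N f
  sumBelow-*ˡ zero    c f = sym (zeroʳ c)
  sumBelow-*ˡ (suc N) c f = trans (+-congˡ (sumBelow-*ˡ N c (f ∘ suc))) (sym (distribˡ c _ _))

  sumBelow-Σ : ∀ N (f : ℕ → A → Carrier) xs →
               sumBelow N (λ k → Σ (map (f k) xs)) ≈ Σ (map (λ x → sumBelow N (λ k → f k x)) xs)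
  sumBelow-Σ zero    f xs = sym (Σ-zero (λ _ → refl) xs)
  sumBelow-Σ (suc N) f xs = begin
    Σ (map (f 0) xs) + sumBelow N (λ k → Σ (map (f (suc k)) xs))     ≈⟨ +-congˡ (sumBelow-Σ N (f ∘ suc) xs) ⟩
    Σ (map (f 0) xs) + Σ (map (λ x → sumBelow N (λ k → f (suc k) x)) xs) ≈⟨ Σ-+ _ _ xs ⟨
    Σ (map (λ x → f 0 x + sumBelow N (λ k → f (suc k) x)) xs)          ∎

  sumBelow-last : ∀ N f → sumBelow (suc N) f ≈ sumBelow N f + f N
  sumBelow-last zero    f = trans (+-identityʳ _) (sym (+-identityˡ _))
  sumBelow-last (suc N) f = trans (+-congˡ (sumBelow-last N (f ∘ suc))) (sym (+-assoc _ _ _))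

  sumBelow-reverse : ∀ N (f : ℕ → Carrier) → sumBelow N (λ k → f (N ∸ k)) ≈ sumBelow N (f ∘ suc)
  sumBelow-reverse zero    f = refl
  sumBelow-reverse (suc N) f = begin
    f (suc N) + sumBelow N (λ k → f (N ∸ k)) ≈⟨ +-congˡ (sumBelow-reverse N f) ⟩
    f (suc N) + sumBelow N (f ∘ suc)         ≈⟨ +-comm _ _ ⟩
    sumBelow N (f ∘ suc) + f (suc N)         ≈⟨ sumBelow-last N (f ∘ suc) ⟨
    sumBelow (suc N) (f ∘ suc)               ∎

  sumBelow-telescope : ∀ N (t : ℕ → Carrier) → sumBelow N (λ k → t k - t (suc k)) ≈ t 0 - t N
  sumBelow-telescope zero    t = sym (-‿inverseʳ _)
  sumBelow-telescope (suc N) t = begin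
    (t 0 - t 1) + sumBelow N (λ k → t (suc k) - t (suc (suc k))) ≈⟨ +-congˡ (sumBelow-telescope N (t ∘ suc)) ⟩
    (t 0 - t 1) + (t 1 - t (suc N))                              ≈⟨ +-assoc _ _ _ ⟩
    t 0 + (- t 1 + (t 1 - t (suc N)))                            ≈⟨ +-congˡ (\\-leftDividesʳ (t 1) (- t (suc N))) ⟩
    t 0 - t (suc N)                                              ∎

  sgn-cong : ∀ k {x y} → x ≈ y → sgn k x ≈ sgn k y
  sgn-cong zero    x≈y = x≈y
  sgn-cong (suc k) x≈y = -‿cong (sgn-cong k x≈y)

  sgn-0# : ∀ k → sgn k 0# ≈ 0#
  sgn-0# zero    = refl
  sgn-0# (suc k) = trans (-‿cong (sgn-0# k)) -0#≈0#

  sgn-+ : ∀ k x y → sgn k (x + y) ≈ sgn k x + sgn k y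
  sgn-+ zero    x y = refl
  sgn-+ (suc k) x y = trans (-‿cong (sgn-+ k x y)) (sym (-‿+-comm _ _))

  sgn-*ʳ : ∀ k x y → sgn k x * y ≈ sgn k (x * y)
  sgn-*ʳ zero    x y = refl
  sgn-*ʳ (suc k) x y = trans (sym (-‿distribˡ-* _ _)) (-‿cong (sgn-*ʳ k x y))

  sgn-‿-comm : ∀ k x → sgn k (- x) ≈ - sgn k x
  sgn-‿-comm zero    x = refl
  sgn-‿-comm (suc k) x = -‿cong (sgn-‿-comm k x)

  sgn-involutive : ∀ k x → sgn k (sgn k x) ≈ x
  sgn-involutive zero    x = refl
  sgn-involutive (suc k) x = trans (-‿cong (sgn-‿-comm k _)) (trans (-‿involutive _) (sgn-involutive k x))

  sgn-+ℕ : ∀ k l x → sgn (k ℕ.+ l) x ≡ sgn k (sgn l x)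
  sgn-+ℕ zero    l x = ≡.refl
  sgn-+ℕ (suc k) l x = ≡.cong -_ (sgn-+ℕ k l x)

  sgn-sumBelow : ∀ k N f → sgn k (sumBelow N f) ≈ sumBelow N (λ m → sgn k (f m))
  sgn-sumBelow k zero    f = sgn-0# k
  sgn-sumBelow k (suc N) f = trans (sgn-+ k _ _) (+-congˡ (sgn-sumBelow k N (f ∘ suc)))

  nat≡×1# : ∀ m → nat m ≡ Mult._×_ m 1#
  nat≡×1# zero    = ≡.refl
  nat≡×1# (suc m) = ≡.cong (1# +_) (nat≡×1# m)

  nat-* : ∀ m k → nat (m ℕ.* k) ≈ nat m * nat k
  nat-* m k rewrite nat≡×1# (m ℕ.* k) | nat≡×1# m | nat≡×1# k = Mult.×1-homo-* m k

  signedFactorial : ℕ → Carrier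
  signedFactorial m = sgn m (nat (m !))

  signedFactorial-suc : ∀ k → signedFactorial k * nat (suc k) ≈ - signedFactorial (suc k)
  signedFactorial-suc k = begin
    sgn k (nat (k !)) * nat (suc k)   ≈⟨ sgn-*ʳ k _ _ ⟩
    sgn k (nat (k !) * nat (suc k))   ≈⟨ sgn-cong k (trans (*-comm _ _) (sym (nat-* (suc k) (k !)))) ⟩
    sgn k (nat (suc k ℕ.* k !))       ≈⟨ -‿involutive _ ⟨
    - signedFactorial (suc k)         ∎

  sumSplits : ℕ → List A → (List A → List A → Carrier) → Carrier
  sumSplits m L f = Σ (map (uncurry f) (splits m L))

  pickSum : (A → Carrier) → (List A → Carrier) → List A → Carrier
  pickSum a h L = Σ (map (uncurry λ i T → a i * h T) (picks L))

  sumSplits-cons : ∀ m x xs (f : List A → List A → Carrier) →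
    sumSplits (suc m) (x ∷ xs) f ≈ sumSplits m xs (λ I T → f (x ∷ I) T) + sumSplits (suc m) xs (λ I T → f I (x ∷ T))
  sumSplits-cons m x xs f = trans (Σ-map-++ (uncurry f) (map (map₁ (x ∷_)) (splits m xs)) _)
    (reflexive (≡.cong₂ _+_ (Σ-map (uncurry f) (map₁ (x ∷_)) (splits m xs)) (Σ-map (uncurry f) (map₂ (x ∷_)) (splits (suc m) xs))))

  sumSplits-one : ∀ L (f : List A → List A → Carrier) → sumSplits 1 L f ≡ Σ (map (uncurry λ x T → f (x ∷ []) T) (picks L))
  sumSplits-one L f = ≡.trans (≡.cong (λ S → Σ (map (uncurry f) S)) (splits-one L)) (Σ-map (uncurry f) (map₁ (_∷ [])) (picks L))

  pickSum-cons : ∀ (a : A → Carrier) h x T → pickSum a h (x ∷ T) ≡ a x * h T + pickSum a (λ U → h (x ∷ U)) T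
  pickSum-cons a h x T = ≡.cong (a x * h T +_) (Σ-map (uncurry λ i U → a i * h U) (map₂ (x ∷_)) (picks T))

  pickSum-cong : ∀ (a : A → Carrier) {h k : List A → Carrier} → (∀ T → h T ≈ k T) → ∀ L → pickSum a h L ≈ pickSum a k L
  pickSum-cong a h≈k L = Σ-cong (λ (x , T) → *-congˡ (h≈k T)) (picks L)

  pickSum-+ : ∀ (a : A → Carrier) h k L → pickSum a (λ T → h T + k T) L ≈ pickSum a h L + pickSum a k L
  pickSum-+ a h k L = trans (Σ-cong (λ _ → distribˡ _ _ _) (picks L)) (Σ-+ _ _ (picks L))

  sumSplits-*ˡ : ∀ m L c (f : List A → List A → Carrier) → sumSplits m L (λ I T → c * f I T) ≈ c * sumSplits m L f
  sumSplits-*ˡ m L c f = Σ-*ˡ c (uncurry f) (splits m L)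

  sumSplits-one-prod : ∀ (a : A → Carrier) h L → sumSplits 1 L (λ I T → Π (map a I) * h T) ≈ pickSum a h L
  sumSplits-one-prod a h L = begin
    sumSplits 1 L (λ I T → Π (map a I) * h T)            ≡⟨ sumSplits-one L (λ I T → Π (map a I) * h T) ⟩
    Σ (map (uncurry λ x T → (a x * 1#) * h T) (picks L)) ≈⟨ Σ-cong (λ _ → *-congʳ (*-identityʳ _)) (picks L) ⟩
    pickSum a h L                                        ∎

  sumBelow-pickSum : ∀ N (c : ℕ → Carrier) (a : A → Carrier) (h : ℕ → List A → Carrier) L →
    sumBelow N (λ m → c m * pickSum a (h m) L) ≈ pickSum a (λ U → sumBelow N (λ m → c m * h m U)) L
  sumBelow-pickSum N c a h L = begin
    sumBelow N (λ m → c m * pickSum a (h m) L)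
      ≈⟨ sumBelow-cong N (λ m _ → sym (Σ-*ˡ (c m) _ (picks L))) ⟩
    sumBelow N (λ m → Σ (map (uncurry λ x U → c m * (a x * h m U)) (picks L)))
      ≈⟨ sumBelow-Σ N (λ m → uncurry λ x U → c m * (a x * h m U)) (picks L) ⟩
    Σ (map (uncurry λ x U → sumBelow N (λ m → c m * (a x * h m U))) (picks L))
      ≈⟨ Σ-cong (λ (x , U) → trans (sumBelow-cong N (λ m _ → x∙yz≈y∙xz _ _ _)) (sumBelow-*ˡ N (a x) _)) (picks L) ⟩
    pickSum a (λ U → sumBelow N (λ m → c m * h m U)) L ∎

  nat-length-pickSum : ∀ (a : A → Carrier) h L → nat (length L) * pickSum a h L ≈ pickSum a (λ U → nat (suc (length U)) * h U) L
  nat-length-pickSum a h L = trans (sym (Σ-*ˡ (nat (length L)) _ (picks L)))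
    (Σ-congᴬ (All.map (λ {(x , U)} e → trans (*-congʳ (reflexive (≡.cong nat e))) (x∙yz≈y∙xz _ _ _)) (picks-length L)))

  -- Each (m+1)-subset arises from m+1 pairs (m-subset, added element).
  sumSplits-pickSum : ∀ (a : A → Carrier) h m L →
    sumSplits m L (λ I T → Π (map a I) * pickSum a h T) ≈ nat (suc m) * sumSplits (suc m) L (λ I T → Π (map a I) * h T)
  sumSplits-pickSum a h zero L = begin
    1# * pickSum a h L + 0#                                 ≈⟨ trans (+-identityʳ _) (*-identityˡ _) ⟩
    pickSum a h L                                           ≈⟨ sumSplits-one-prod a h L ⟨
    sumSplits 1 L (λ I T → Π (map a I) * h T)               ≈⟨ solve 1 (λ s → s := (con 1 :+ con 0) :* s) refl _ ⟩
    nat 1 * sumSplits 1 L (λ I T → Π (map a I) * h T)       ∎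
  sumSplits-pickSum a h (suc m) []       = sym (zeroʳ _)
  sumSplits-pickSum {A = A} a h (suc m) (x ∷ xs) = begin
    sumSplits (suc m) (x ∷ xs) (λ I T → Π (map a I) * pickSum a h T)
      ≈⟨ sumSplits-cons m x xs _ ⟩
    sumSplits m xs (λ I T → (a x * Π (map a I)) * pickSum a h T) + sumSplits (suc m) xs (λ I T → Π (map a I) * pickSum a h (x ∷ T))
      ≈⟨ +-cong withHead withoutHead ⟩
    a x * (nat (suc m) * U) + (a x * U + nat (suc (suc m)) * V)
      ≈⟨ solve 4 (λ ax N U V → ax :* (N :* U) :+ (ax :* U :+ (con 1 :+ N) :* V) := (con 1 :+ N) :* (ax :* U :+ V)) refl (a x) (nat (suc m)) U V ⟩
    nat (suc (suc m)) * (a x * U + V)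
      ≈⟨ *-congˡ (sym (trans (sumSplits-cons (suc m) x xs g) (+-congʳ (factorHead (suc m) (λ _ → h))))) ⟩
    nat (suc (suc m)) * sumSplits (suc (suc m)) (x ∷ xs) g ∎
    where
    g : List A → List A → Carrier
    g I T = Π (map a I) * h T
    h′ : List A → Carrier
    h′ T = h (x ∷ T)
    U = sumSplits (suc m) xs g
    V = sumSplits (suc (suc m)) xs (λ I T → Π (map a I) * h′ T)
    factorHead : ∀ k (f : List A → List A → Carrier) →
                 sumSplits k xs (λ I T → (a x * Π (map a I)) * f I T) ≈ a x * sumSplits k xs (λ I T → Π (map a I) * f I T)
    factorHead k f = trans (Σ-cong (λ _ → *-assoc _ _ _) (splits k xs)) (sumSplits-*ˡ k xs (a x) _)
    withHead : sumSplits m xs (λ I T → (a x * Π (map a I)) * pickSum a h T) ≈ a x * (nat (suc m) * U)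
    withHead = trans (factorHead m (λ _ → pickSum a h)) (*-congˡ (sumSplits-pickSum a h m xs))
    withoutHead : sumSplits (suc m) xs (λ I T → Π (map a I) * pickSum a h (x ∷ T)) ≈ a x * U + nat (suc (suc m)) * V
    withoutHead = begin
      sumSplits (suc m) xs (λ I T → Π (map a I) * pickSum a h (x ∷ T))
        ≈⟨ Σ-cong (λ (I , T) → trans (*-congˡ (reflexive (pickSum-cons a h x T))) (distribˡ _ _ _)) (splits (suc m) xs) ⟩
      Σ (map (uncurry λ I T → Π (map a I) * (a x * h T) + Π (map a I) * pickSum a h′ T) (splits (suc m) xs))
        ≈⟨ Σ-+ _ _ (splits (suc m) xs) ⟩
      sumSplits (suc m) xs (λ I T → Π (map a I) * (a x * h T)) + sumSplits (suc m) xs (λ I T → Π (map a I) * pickSum a h′ T)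
        ≈⟨ +-cong (trans (Σ-cong (λ _ → x∙yz≈y∙xz _ _ _) (splits (suc m) xs)) (sumSplits-*ˡ (suc m) xs (a x) g))
                  (sumSplits-pickSum a h′ (suc m) xs) ⟩
      a x * U + nat (suc (suc m)) * V ∎

  sumSplits-pickSum-comm : ∀ (a : A → Carrier) (f : List A → List A → Carrier) m L →
    sumSplits m L (λ I T → pickSum a (f I) T) ≈ pickSum a (λ U → sumSplits m U f) L
  sumSplits-pickSum-comm a f zero    L        = trans (+-identityʳ _) (pickSum-cong a (λ _ → sym (+-identityʳ _)) L)
  sumSplits-pickSum-comm a f (suc m) []       = refl
  sumSplits-pickSum-comm {A = A} a f (suc m) (x ∷ xs) = begin
    sumSplits (suc m) (x ∷ xs) (λ I T → pickSum a (f I) T)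
      ≈⟨ sumSplits-cons m x xs _ ⟩
    sumSplits m xs (λ I T → pickSum a (f (x ∷ I)) T) + sumSplits (suc m) xs (λ I T → pickSum a (f I) (x ∷ T))
      ≈⟨ +-cong (sumSplits-pickSum-comm a f₁ m xs) withoutHead ⟩
    P₁ + (a x * S + P₂)
      ≈⟨ solve 3 (λ p s q → p :+ (s :+ q) := s :+ (p :+ q)) refl P₁ (a x * S) P₂ ⟩
    a x * S + (P₁ + P₂)
      ≈⟨ +-congˡ (sym (trans (pickSum-cong a (λ U → sumSplits-cons m x U f) xs) (pickSum-+ a _ _ xs))) ⟩
    a x * S + pickSum a (λ U → sumSplits (suc m) (x ∷ U) f) xs
      ≡⟨ pickSum-cons a (λ U → sumSplits (suc m) U f) x xs ⟨
    pickSum a (λ U → sumSplits (suc m) U f) (x ∷ xs) ∎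
    where
    f₁ f₂ : List A → List A → Carrier
    f₁ I T = f (x ∷ I) T
    f₂ I T = f I (x ∷ T)
    S  = sumSplits (suc m) xs f
    P₁ = pickSum a (λ U → sumSplits m U f₁) xs
    P₂ = pickSum a (λ U → sumSplits (suc m) U f₂) xs
    withoutHead : sumSplits (suc m) xs (λ I T → pickSum a (f I) (x ∷ T)) ≈ a x * S + P₂
    withoutHead = begin
      sumSplits (suc m) xs (λ I T → pickSum a (f I) (x ∷ T))
        ≈⟨ Σ-cong (λ (I , T) → reflexive (pickSum-cons a (f I) x T)) (splits (suc m) xs) ⟩
      Σ (map (uncurry λ I T → a x * f I T + pickSum a (f₂ I) T) (splits (suc m) xs))
        ≈⟨ Σ-+ _ _ (splits (suc m) xs) ⟩
      sumSplits (suc m) xs (λ I T → a x * f I T) + sumSplits (suc m) xs (λ I T → pickSum a (f₂ I) T)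
        ≈⟨ +-cong (sumSplits-*ˡ (suc m) xs (a x) f) (sumSplits-pickSum-comm a f₂ (suc m) xs) ⟩
      a x * S + P₂ ∎

  Σ-arrangements-suc : ∀ k T (h : List A → Carrier) →
    Σ (map h (arrangements (suc k) T)) ≈ Σ (map (uncurry λ y U → Σ (map (h ∘ (y ∷_)) (arrangements k U))) (picks T))
  Σ-arrangements-suc k T h = trans (Σ-concatMap h _ (picks T)) (Σ-cong (λ (y , U) → reflexive (Σ-map h (y ∷_) (arrangements k U))) (picks T))

  Σ-arrangements-zero : ∀ k T {h : List A → Carrier} → (∀ t → length t ≡ k → h t ≈ 0#) → Σ (map h (arrangements k T)) ≈ 0#
  Σ-arrangements-zero zero    T h≈0 = trans (+-identityʳ _) (h≈0 [] ≡.refl)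
  Σ-arrangements-zero (suc k) T h≈0 = trans (Σ-arrangements-suc k T _)
    (Σ-zero (λ (y , U) → Σ-arrangements-zero k U (λ t lt → h≈0 (y ∷ t) (≡.cong suc lt))) (picks T))

  chainSum : (n : ℕ) → (A → Fin n → Carrier) → List A → Carrier
  chainSum n α t = Σ (map (λ js → Π (zipWith α t js)) (choose (length t) (allFin n)))

  arrangementSum : (n : ℕ) → (A → Fin n → Carrier) → List A → Carrier
  arrangementSum n α T = Σ (map (chainSum n α) (arrangements (length T) T))

  powerSum : (n : ℕ) → (A → Fin n → Carrier) → List A → Carrier
  powerSum n α I = Σ (map (λ j → Π (map (λ i → α i j) I)) (allFin n))

  chainSum-long : ∀ n α (t : List A) → n < length t → chainSum n α t ≈ 0#
  chainSum-long n α t n<t = reflexive (≡.cong (λ S → Σ (map (λ js → Π (zipWith α t js)) S))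
    (choose-short (length t) (allFin n) (≡.subst (_< length t) (≡.sym (List.length-tabulate id)) n<t)))

  splitSum : (n : ℕ) → (A → Fin n → Carrier) → ℕ → List A → Carrier
  splitSum n α m L = sumSplits m L (λ I T → powerSum n α I * arrangementSum n α T)

  newtonSum : (n : ℕ) → (A → Fin n → Carrier) → ℕ → List A → Carrier
  newtonSum n α N L = sumBelow N (λ m → signedFactorial (suc m) * splitSum n α (suc m) L)
                      + nat (length L) * arrangementSum n α L

  module _ {n : ℕ} (α : A → Fin (suc n) → Carrier) where

    atZero : A → Carrier
    atZero i = α i Fin.zero

    shift : A → Fin n → Carrier
    shift i j = α i (Fin.suc j)

    powerSum-suc : ∀ I → powerSum (suc n) α I ≈ Π (map atZero I) + powerSum n shift I
    powerSum-suc I = begin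
      Σ (map g (allFin (suc n)))                      ≡⟨ ≡.cong (λ L → Σ (map g L)) (allFin-suc n) ⟩
      g Fin.zero + Σ (map g (map Fin.suc (allFin n))) ≡⟨ ≡.cong (g Fin.zero +_) (Σ-map g Fin.suc (allFin n)) ⟩
      g Fin.zero + Σ (map (g ∘ Fin.suc) (allFin n))   ∎
      where
      g = λ j → Π (map (λ i → α i j) I)

    chainSum-suc : ∀ i t → chainSum (suc n) α (i ∷ t) ≈ atZero i * chainSum n shift t + chainSum n shift (i ∷ t)
    chainSum-suc i t = begin
      Σ (map F (choose (suc k) (allFin (suc n))))
        ≡⟨ ≡.cong (λ S → Σ (map F S)) (choose-suc-allFin k n) ⟩
      Σ (map F (map ((Fin.zero ∷_) ∘ map Fin.suc) (choose k Js) ++ map (map Fin.suc) (choose (suc k) Js)))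
        ≈⟨ Σ-map-++ F (map ((Fin.zero ∷_) ∘ map Fin.suc) (choose k Js)) _ ⟩
      Σ (map F (map ((Fin.zero ∷_) ∘ map Fin.suc) (choose k Js))) + Σ (map F (map (map Fin.suc) (choose (suc k) Js)))
        ≡⟨ ≡.cong₂ _+_ (Σ-map F _ (choose k Js)) (Σ-map F _ (choose (suc k) Js)) ⟩
      Σ (map (λ js → F (Fin.zero ∷ map Fin.suc js)) (choose k Js)) + Σ (map (F ∘ map Fin.suc) (choose (suc k) Js))
        ≡⟨ ≡.cong₂ _+_ (≡.cong Σ (List.map-cong (λ js → ≡.cong (λ z → atZero i * Π z) (zipWith-mapʳ α Fin.suc t js)) (choose k Js)))
                       (≡.cong Σ (List.map-cong (λ js → ≡.cong Π (zipWith-mapʳ α Fin.suc (i ∷ t) js)) (choose (suc k) Js))) ⟩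
      Σ (map (λ js → atZero i * Π (zipWith shift t js)) (choose k Js)) + chainSum n shift (i ∷ t)
        ≈⟨ +-congʳ (Σ-*ˡ (atZero i) (λ js → Π (zipWith shift t js)) (choose k Js)) ⟩
      atZero i * chainSum n shift t + chainSum n shift (i ∷ t) ∎
      where
      k  = length t
      Js = allFin n
      F  = λ js → Π (zipWith α (i ∷ t) js)

    arrangementSum-suc : ∀ T → arrangementSum (suc n) α T ≈ arrangementSum n shift T + pickSum atZero (arrangementSum n shift) T
    arrangementSum-suc []       = sym (+-identityʳ _)
    arrangementSum-suc (x ∷ xs) = begin
      Σ (map (chainSum (suc n) α) (arrangements (suc k) T))
        ≈⟨ Σ-arrangements-suc k T _ ⟩
      Σ (map (uncurry λ y U → over U (chainSum (suc n) α ∘ (y ∷_))) (picks T))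
        ≈⟨ Σ-cong (λ (y , U) → splitHead y U) (picks T) ⟩
      Σ (map (uncurry λ y U → atZero y * over U χ + over U (χ ∘ (y ∷_))) (picks T))
        ≈⟨ Σ-+ _ _ (picks T) ⟩
      Σ (map (uncurry λ y U → atZero y * over U χ) (picks T)) + Σ (map (uncurry λ y U → over U (χ ∘ (y ∷_))) (picks T))
        ≈⟨ +-cong (Σ-congᴬ (All.map (λ {p} e → *-congˡ (overLength {proj₂ p} e)) (picks-length T))) (sym (Σ-arrangements-suc k T χ)) ⟩
      pickSum atZero (arrangementSum n shift) T + arrangementSum n shift T
        ≈⟨ +-comm _ _ ⟩
      arrangementSum n shift T + pickSum atZero (arrangementSum n shift) T ∎
      where
      T = x ∷ xs
      k = length xs
      χ = chainSum n shift
      over : List A → (List A → Carrier) → Carrier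
      over U h = Σ (map h (arrangements k U))
      overLength : ∀ {U} → length T ≡ suc (length U) → over U χ ≈ arrangementSum n shift U
      overLength {U} e = reflexive (≡.cong (λ l → Σ (map χ (arrangements l U))) (ℕₚ.suc-injective e))
      splitHead : ∀ y U → over U (chainSum (suc n) α ∘ (y ∷_)) ≈ atZero y * over U χ + over U (χ ∘ (y ∷_))
      splitHead y U = trans (Σ-cong (chainSum-suc y) (arrangements k U))
                            (trans (Σ-+ _ _ (arrangements k U)) (+-congʳ (Σ-*ˡ (atZero y) χ (arrangements k U))))

    headSplitSum : ℕ → List A → Carrier
    headSplitSum m L = sumSplits m L (λ I T → Π (map atZero I) * arrangementSum n shift T)

    splitSum-suc : ∀ m L → splitSum (suc n) α m L ≈ splitSum n shift m L + (headSplitSum m L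
                     + (nat (suc m) * headSplitSum (suc m) L + pickSum atZero (splitSum n shift m) L))
    splitSum-suc m L = begin
      splitSum (suc n) α m L
        ≈⟨ Σ-cong (λ (I , T) → trans (*-cong (powerSum-suc I) (arrangementSum-suc T)) (expand _ _ _ _)) (splits m L) ⟩
      sumSplits m L (λ I T → p I * e T + (π I * e T + (π I * q T + p I * q T)))
        ≈⟨ trans (Σ-+ _ _ (splits m L)) (+-congˡ (trans (Σ-+ _ _ (splits m L)) (+-congˡ (Σ-+ _ _ (splits m L))))) ⟩
      splitSum n shift m L + (headSplitSum m L + (sumSplits m L (λ I T → π I * q T) + sumSplits m L (λ I T → p I * q T)))
        ≈⟨ +-congˡ (+-congˡ (+-cong (sumSplits-pickSum atZero e m L) powerTimesPicks)) ⟩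
      splitSum n shift m L + (headSplitSum m L + (nat (suc m) * headSplitSum (suc m) L + pickSum atZero (splitSum n shift m) L)) ∎
      where
      π = λ I → Π (map atZero I)
      p = powerSum n shift
      e = arrangementSum n shift
      q = pickSum atZero e
      expand : ∀ x y z w → (x + y) * (z + w) ≈ y * z + (x * z + (x * w + y * w))
      expand = solve 4 (λ x y z w → (x :+ y) :* (z :+ w) := y :* z :+ (x :* z :+ (x :* w :+ y :* w))) refl
      powerTimesPicks : sumSplits m L (λ I T → p I * q T) ≈ pickSum atZero (splitSum n shift m) L
      powerTimesPicks = begin
        sumSplits m L (λ I T → p I * q T)
          ≈⟨ Σ-cong (λ (I , T) → trans (sym (Σ-*ˡ (p I) _ (picks T))) (Σ-cong (λ _ → x∙yz≈y∙xz _ _ _) (picks T))) (splits m L) ⟩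
        sumSplits m L (λ I T → pickSum atZero (λ U → p I * e U) T)
          ≈⟨ sumSplits-pickSum-comm atZero (λ I U → p I * e U) m L ⟩
        pickSum atZero (splitSum n shift m) L ∎

    newtonSum-suc : ∀ N L → length L ≤ N → newtonSum (suc n) α N L ≈ newtonSum n shift N L + pickSum atZero (newtonSum n shift N) L
    newtonSum-suc N L |L|≤N = begin
      sumBelow N (λ m → W (suc m) * splitSum (suc n) α (suc m) L) + nat (length L) * arrangementSum (suc n) α L
        ≈⟨ +-cong (trans (sumBelow-cong N (λ m _ → signedSplitSum-suc m)) splitPart) lengthPart ⟩
      (H + (- Pe + PH)) + (nat (length L) * e L + (Pe + Pl))
        ≈⟨ solve 6 (λ h m q y p u → (h :+ (m :+ q)) :+ (y :+ (p :+ u)) := ((h :+ y) :+ (q :+ u)) :+ (m :+ p)) refl H (- Pe) PH _ Pe Pl ⟩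
      ((H + nat (length L) * e L) + (PH + Pl)) + (- Pe + Pe)
        ≈⟨ trans (+-congˡ (-‿inverseˡ Pe)) (+-identityʳ _) ⟩
      (H + nat (length L) * e L) + (PH + Pl)
        ≈⟨ +-congˡ (sym (pickSum-+ atZero _ _ L)) ⟩
      newtonSum n shift N L + pickSum atZero (newtonSum n shift N) L ∎
      where
      W = signedFactorial
      e = arrangementSum n shift
      t : ℕ → Carrier
      t m = W m * headSplitSum m L
      H  = sumBelow N (λ m → W (suc m) * splitSum n shift (suc m) L)
      Pe = pickSum atZero e L
      PH = pickSum atZero (λ U → sumBelow N (λ m → W (suc m) * splitSum n shift (suc m) U)) L
      Pl = pickSum atZero (λ U → nat (length U) * e U) L

      summand : ℕ → Carrier
      summand m = W (suc m) * splitSum n shift (suc m) L + ((t (suc m) - t (suc (suc m))) + W (suc m) * pickSum atZero (splitSum n shift (suc m)) L)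

      signedSplitSum-suc : ∀ m → W (suc m) * splitSum (suc n) α (suc m) L ≈ summand m
      signedSplitSum-suc m = begin
        W (suc m) * splitSum (suc n) α (suc m) L
          ≈⟨ *-congˡ (splitSum-suc (suc m) L) ⟩
        W (suc m) * (splitSum n shift (suc m) L + (headSplitSum (suc m) L + (nat (suc (suc m)) * headSplitSum (suc (suc m)) L + _)))
          ≈⟨ solve 5 (λ w s a b q → w :* (s :+ (a :+ (b :+ q))) := w :* s :+ ((w :* a :+ w :* b) :+ w :* q)) refl _ _ _ _ _ ⟩
        W (suc m) * splitSum n shift (suc m) L + ((t (suc m) + W (suc m) * (nat (suc (suc m)) * headSplitSum (suc (suc m)) L)) + _)
          ≈⟨ +-congˡ (+-congʳ (+-congˡ telescoping)) ⟩
        summand m ∎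
        where
        telescoping : W (suc m) * (nat (suc (suc m)) * headSplitSum (suc (suc m)) L) ≈ - t (suc (suc m))
        telescoping = trans (sym (*-assoc _ _ _)) (trans (*-congʳ (signedFactorial-suc (suc m))) (sym (-‿distribˡ-* _ _)))

      t₁ : t 1 ≈ - Pe
      t₁ = begin
        - (1# + 0#) * headSplitSum 1 L ≈⟨ -‿distribˡ-* _ _ ⟨
        - ((1# + 0#) * headSplitSum 1 L) ≈⟨ -‿cong (solve 1 (λ s → (con 1 :+ con 0) :* s := s) refl _) ⟩
        - headSplitSum 1 L               ≈⟨ -‿cong (sumSplits-one-prod atZero e L) ⟩
        - Pe                             ∎

      t[1+N] : t (suc N) ≈ 0#
      t[1+N] = trans (*-congˡ (reflexive (≡.cong (λ S → Σ (map _ S)) (splits-short (suc N) L (s≤s |L|≤N))))) (zeroʳ _)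

      splitPart : sumBelow N summand ≈ H + (- Pe + PH)
      splitPart = begin
        sumBelow N summand
          ≈⟨ trans (sumBelow-+ N _ _) (+-congˡ (sumBelow-+ N _ _)) ⟩
        H + (sumBelow N (λ m → t (suc m) - t (suc (suc m))) + sumBelow N (λ m → W (suc m) * pickSum atZero (splitSum n shift (suc m)) L))
          ≈⟨ +-congˡ (+-cong (sumBelow-telescope N (t ∘ suc)) (sumBelow-pickSum N (W ∘ suc) atZero (splitSum n shift ∘ suc) L)) ⟩
        H + ((t 1 - t (suc N)) + PH)
          ≈⟨ +-congˡ (+-congʳ (trans (+-cong t₁ (trans (-‿cong t[1+N]) -0#≈0#)) (+-identityʳ _))) ⟩
        H + (- Pe + PH) ∎

      lengthPart : nat (length L) * arrangementSum (suc n) α L ≈ nat (length L) * e L + (Pe + Pl)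
      lengthPart = begin
        nat (length L) * arrangementSum (suc n) α L
          ≈⟨ trans (*-congˡ (arrangementSum-suc L)) (distribˡ _ _ _) ⟩
        nat (length L) * e L + nat (length L) * Pe
          ≈⟨ +-congˡ (nat-length-pickSum atZero e L) ⟩
        nat (length L) * e L + pickSum atZero (λ U → (1# + nat (length U)) * e U) L
          ≈⟨ +-congˡ (trans (pickSum-cong atZero (λ U → trans (distribʳ _ _ _) (+-congʳ (*-identityˡ _))) L) (pickSum-+ atZero _ _ L)) ⟩
        nat (length L) * e L + (Pe + Pl) ∎

  newtonSum-zero : ∀ (α : A → Fin 0 → Carrier) N L → newtonSum 0 α N L ≈ 0#
  newtonSum-zero α N L = trans (+-cong (sumBelow-zero N (λ m → trans (*-congˡ (Σ-zero (λ _ → zeroˡ _) (splits (suc m) L))) (zeroʳ _)))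
                                       (lengthTerm L))
                               (+-identityˡ _)
    where
    lengthTerm : ∀ L → nat (length L) * arrangementSum 0 α L ≈ 0#
    lengthTerm []       = zeroˡ _
    lengthTerm (x ∷ xs) = trans (*-congˡ (Σ-arrangements-zero (suc (length xs)) (x ∷ xs)
                            (λ t e → chainSum-long 0 α t (≡.subst (0 <_) (≡.sym e) ℕ.z<s)))) (zeroʳ _)

  newtonSum-vanishes : ∀ n (α : A → Fin n → Carrier) N L → length L ≤ N → newtonSum n α N L ≈ 0#
  newtonSum-vanishes zero    α N L _      = newtonSum-zero α N L
  newtonSum-vanishes {A = A} (suc n) α N L |L|≤N = begin
    newtonSum (suc n) α N L
      ≈⟨ newtonSum-suc α N L |L|≤N ⟩
    newtonSum n (shift α) N L + pickSum (atZero α) (newtonSum n (shift α) N) L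
      ≈⟨ +-cong (newtonSum-vanishes n (shift α) N L |L|≤N) (Σ-zeroᴬ (All.map (λ {p} → vanishes {p}) (picks-length L))) ⟩
    0# + 0#
      ≈⟨ +-identityˡ 0# ⟩
    0# ∎
    where
    vanishes : ∀ {p : A × List A} → length L ≡ suc (length (proj₂ p)) → atZero α (proj₁ p) * newtonSum n (shift α) N (proj₂ p) ≈ 0#
    vanishes {p} e = trans (*-congˡ (newtonSum-vanishes n (shift α) N (proj₂ p) |U|≤N)) (zeroʳ _)
      where |U|≤N = ℕₚ.≤-trans (ℕₚ.n≤1+n _) (≡.subst (_≤ N) e |L|≤N)

  module _ {r n : ℕ} (α : Fin r → Fin n → Carrier) where

    length-allFin : length (allFin r) ≡ r
    length-allFin = List.length-tabulate id

    term≈splitSum : ∀ k → k < r → sgn r (term r n α k) ≈ signedFactorial (r ∸ k) * splitSum n α (r ∸ k) (allFin r)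
    term≈splitSum k k<r = begin
      sgn r (sgn k Z)                             ≡⟨ ≡.cong (λ j → sgn j (sgn k Z)) (≡.sym m+k≡r) ⟩
      sgn (m ℕ.+ k) (sgn k Z)                     ≡⟨ sgn-+ℕ m k _ ⟩
      sgn m (sgn k (sgn k Z))                     ≈⟨ sgn-cong m (sgn-involutive k Z) ⟩
      sgn m Z                                     ≈⟨ sgn-cong m (Σ-*ˡ (nat (m !)) PX (choose m L)) ⟩
      sgn m (nat (m !) * Σ (map PX (choose m L))) ≈⟨ sgn-*ʳ m _ _ ⟨
      signedFactorial m * Σ (map PX (choose m L)) ≈⟨ *-congˡ PX≈splitSum ⟩
      signedFactorial m * splitSum n α m L        ∎
      where
      m = r ∸ k
      L = allFin r
      m+k≡r : m ℕ.+ k ≡ r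
      m+k≡r = ℕₚ.m∸n+n≡m (ℕₚ.<⇒≤ k<r)
      PX : List (Fin r) → Carrier
      PX is = P r n α is * X r n α k is
      Z = Σ (map (λ is → nat (m !) * PX is) (choose m L))
      F : List (Fin r) → List (Fin r) → Carrier
      F I T = powerSum n α I * Σ (map (chainSum n α) (arrangements k T))
      F≈ : ∀ {(I , T) : List (Fin r) × List (Fin r)} → length T ℕ.+ m ≡ length L → F I T ≈ powerSum n α I * arrangementSum n α T
      F≈ {I , T} e = reflexive (≡.cong (λ l → powerSum n α I * Σ (map (chainSum n α) (arrangements l T)))
        (≡.sym (ℕₚ.+-cancelʳ-≡ m (length T) k (≡.trans e (≡.trans length-allFin (≡.trans (≡.sym m+k≡r) (ℕₚ.+-comm m k)))))))
      PX≈splitSum : Σ (map PX (choose m L)) ≈ splitSum n α m L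
      PX≈splitSum = begin
        Σ (map PX (choose m L))                                      ≡⟨ Σ-map (uncurry F) (λ is → is , L ∖ is) (choose m L) ⟨
        Σ (map (uncurry F) (map (λ is → is , L ∖ is) (choose m L))) ≡⟨ ≡.cong (λ S → Σ (map (uncurry F) S)) (choose-with-complement m (Unique.allFin⁺ r)) ⟩
        sumSplits m L F                                              ≈⟨ Σ-congᴬ (All.map (λ {p} → F≈ {p}) (splits-length m L)) ⟩
        splitSum n α m L                                             ∎

    signed-LHS₂≈newtonSum : sgn r (LHS₂ r n α) ≈ newtonSum n α r (allFin r)
    signed-LHS₂≈newtonSum = begin
      sgn r (Σ (map (term r n α) (upTo r)) + sgn r (nat r * Y r n α))
        ≈⟨ sgn-+ r _ _ ⟩
      sgn r (Σ (map (term r n α) (upTo r))) + sgn r (sgn r (nat r * Y r n α))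
        ≈⟨ +-cong (sgn-cong r (reflexive (Σ-upTo r _))) (sgn-involutive r _) ⟩
      sgn r (sumBelow r (term r n α)) + nat r * Y r n α
        ≈⟨ +-congʳ (sgn-sumBelow r r _) ⟩
      sumBelow r (λ k → sgn r (term r n α k)) + nat r * Y r n α
        ≈⟨ +-congʳ (trans (sumBelow-cong r term≈splitSum) (sumBelow-reverse r g)) ⟩
      sumBelow r (g ∘ suc) + nat r * Y r n α
        ≡⟨ ≡.cong (λ l → sumBelow r (g ∘ suc) + nat l * Σ (map (chainSum n α) (arrangements l (allFin r)))) (≡.sym length-allFin) ⟩
      newtonSum n α r (allFin r) ∎
      where
      g : ℕ → Carrier
      g m = signedFactorial m * splitSum n α m (allFin r)

    LHS₂≈0 : LHS₂ r n α ≈ 0#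
    LHS₂≈0 = begin
      LHS₂ r n α                         ≈⟨ sgn-involutive r _ ⟨
      sgn r (sgn r (LHS₂ r n α))         ≈⟨ sgn-cong r signed-LHS₂≈newtonSum ⟩
      sgn r (newtonSum n α r (allFin r)) ≈⟨ sgn-cong r (newtonSum-vanishes n α r (allFin r) (ℕₚ.≤-reflexive length-allFin)) ⟩
      sgn r 0#                           ≈⟨ sgn-0# r ⟩
      0#                                 ∎

    LHS₁≈LHS₂ : n < r → LHS₁ r n α ≈ LHS₂ r n α
    LHS₁≈LHS₂ n<r = begin
      Σ (map (term r n α) (upTo (suc r)))                  ≡⟨ Σ-upTo (suc r) _ ⟩
      sumBelow (suc r) (term r n α)                        ≈⟨ sumBelow-last r _ ⟩
      sumBelow r (term r n α) + term r n α r               ≈⟨ +-congˡ (trans lastTerm≈0 (sym YTerm≈0)) ⟩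
      sumBelow r (term r n α) + sgn r (nat r * Y r n α)    ≡⟨ ≡.cong (_+ sgn r (nat r * Y r n α)) (Σ-upTo r _) ⟨
      LHS₂ r n α                                           ∎
      where
      long : ∀ t → length t ≡ r → chainSum n α t ≈ 0#
      long t e = chainSum-long n α t (≡.subst (n <_) (≡.sym e) n<r)
      lastTerm≈0 : term r n α r ≈ 0#
      lastTerm≈0 = trans (sgn-cong r (Σ-zero vanishes (choose (r ∸ r) (allFin r)))) (sgn-0# r)
        where
        vanishes : ∀ is → nat ((r ∸ r) !) * (P r n α is * X r n α r is) ≈ 0#
        vanishes is = trans (*-congˡ (trans (*-congˡ (Σ-arrangements-zero r (complement r is) long)) (zeroʳ _))) (zeroʳ _)
      YTerm≈0 : sgn r (nat r * Y r n α) ≈ 0#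
      YTerm≈0 = trans (sgn-cong r (trans (*-congˡ (Σ-arrangements-zero r (allFin r) long)) (zeroʳ _))) (sgn-0# r)

theorem1p8 : {c ℓ : Level} (R : CommutativeRing c ℓ) (r n : ℕ) → 1 ≤ r → 1 ≤ n →
    (α : Fin r → Fin n → CommutativeRing.Carrier R) →
    (n < r → CommutativeRing._≈_ R (Poly.LHS₁ R r n α) (CommutativeRing.0# R)) ×
    (r ≤ n → CommutativeRing._≈_ R (Poly.LHS₂ R r n α) (CommutativeRing.0# R))
theorem1p8 R r n _ _ α =
  (λ n<r → CommutativeRing.trans R (LHS₁≈LHS₂ R α n<r) (LHS₂≈0 R α)) , (λ _ → LHS₂≈0 R α)
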